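{- Let $p$ be a prime with $p\mid F_{p+1}$, and for $n\ge1$ let $R_n$ be the $n\times n$ matrix with $(i,j)$ entry $\binom{i-1}{n-j}$. Then $R_{2k+1}^{\,p+1}\equiv I_{2k+1}\pmod p$ for every $k\ge0$, and $R_{2k}^{\,p+1}\equiv -I_{2k}\pmod p$ for every $k\ge1$.
   Context: Convention: $\binom{m}{k}=0$ if $k<0$ or $k>m$. The Fibonacci sequence is $F_0=0$, $F_1=1$, $F_{m+1}=F_m+F_{m-1}$. Matrix congruences modulo $p$ are entrywise; $I_n$ is the identity matrix. -}

module Defs where

open import Data.Nat as ℕ using (ℕ; zero; suc; _∸_)
open import Data.Nat.Combinatorics using (_C_)
open import Data.Fin using (Fin; toℕ; _≟_) renaming (zero to fzero; suc to fsuc)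
open import Data.Integer as ℤ using (ℤ; +_; -_)
open import Data.Integer.Divisibility using (_∣_)
open import Relation.Nullary using (does)
open import Data.Bool using (if_then_else_)

fib : ℕ → ℕ
fib zero = 0
fib (suc zero) = 1
fib (suc (suc m)) = fib (suc m) ℕ.+ fib m

Mat : ℕ → Set
Mat n = Fin n → Fin n → ℤ

Σᶠ : ∀ {n} → (Fin n → ℤ) → ℤ
Σᶠ {zero} f = + 0
Σᶠ {suc n} f = f fzero ℤ.+ Σᶠ (λ i → f (fsuc i))

_⊗_ : ∀ {n} → Mat n → Mat n → Mat n
(A ⊗ B) i j = Σᶠ (λ k → A i k ℤ.* B k j)

identity : ∀ n → Mat n
identity n i j = if does (i ≟ j) then + 1 else + 0

negM : ∀ {n} → Mat n → Mat n
negM A i j = - A i j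

_^ᴹ_ : ∀ {n} → Mat n → ℕ → Mat n
_^ᴹ_ {n} A zero = identity n
A ^ᴹ suc e = A ⊗ (A ^ᴹ e)

-- R n : (i,j) entry (1-indexed) is binom(i-1, n-j); here 0-indexed
-- i' = i-1, j' = j-1, so the entry is binom(i', n-1-j') (k ≤ n-1 always ≥ 0,
-- and stdlib's _C_ is 0 when k > m, matching the convention)
R : ∀ n → Mat n
R n i j = + (toℕ i C (n ∸ suc (toℕ j)))

_≡ᴹ_[mod_] : ∀ {n} → Mat n → Mat n → ℕ → Set
A ≡ᴹ B [mod p ] = ∀ i j → (+ p) ∣ (A i j ℤ.- B i j)

-- Row i of R n holds the binomial coefficients of y ^ (n-1-i) (x + y) ^ i, so R n maps the vector of
-- monomials x ^ (n-1-k) y ^ k to the same vector at (y, x + y). Iterating, R n ^ (m+1) maps it to the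
-- vector at (F m x + F (m+1) y, F (m+1) x + F (m+2) y); taking x = 1 and comparing polynomials in y,
-- row i of R n ^ (m+1) lists the coefficients of (F m + F (m+1) y) ^ (n-1-i) (F (m+1) + F (m+2) y) ^ i.
-- If p ∣ F (p+1), then F p ≡ -1 (mod p), read off from (1 + √5) ^ p and (1 + √5) ^ (p+1) modulo p;
-- for m = p this product is then ≡ (-1) ^ (n-1) y ^ i, which is row i of (-1) ^ (n-1) I.
module Submission where

open import Defs
open import Data.Nat as ℕ using (ℕ; zero; suc; _∸_; z≤n; s≤s; _!)
import Data.Nat.Properties as ℕ
open import Data.Nat.Properties using (_!*_!≢0)
open import Data.Nat.Divisibility as ℕ using (>⇒∤)
open import Data.Nat.DivMod using (m/n*n≡m)
open import Data.Nat.Combinatorics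
  using (_C_; nCk+nC[k+1]≡[n+1]C[k+1]; k>n⇒nCk≡0; nCn≡1; nCk≡n!/k![n-k]!; k![n∸k]!∣n!)
open import Data.Nat.Primality using (Prime; euclidsLemma; prime⇒nonTrivial; prime⇒irreducible)
open import Data.Fin using (Fin; toℕ) renaming (zero to fzero; suc to fsuc)
open import Data.Fin.Properties using (toℕ<n; opposite-prop)
open import Data.Fin.Permutation using (reverse)
open import Data.Integer using (ℤ; +_; -_; -1ℤ; ∣_∣)
import Data.Integer.Properties as ℤ
open import Data.Integer.Divisibility.Signed as Signed using (divides; ∣ᵤ⇒∣; ∣⇒∣ᵤ)
open import Data.Integer.Tactic.RingSolver using (solve-∀)
open import Algebra.Properties.Semiring.Sum ℤ.+-*-semiring
  using (sum; sum-cong-≗; ∑-distrib-+; ∑-comm; *-distribˡ-sum; *-distribʳ-sum; ∑-permute)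
open import Data.Product using (_×_; _,_; proj₁; proj₂; ∃-syntax)
open import Data.Sum using (_⊎_; inj₁; inj₂)
open import Function using (_∘_)
open import Relation.Nullary using (¬_; contradiction; yes; no)
open import Relation.Binary.Bundles using (Setoid)
import Relation.Binary.Reasoning.Setoid as SetoidReasoning
open import Relation.Binary.PropositionalEquality

-- Integer arithmetic is opened only locally, since the statement of theorem12 uses ℕ's _+_ and _*_.
module _ where

  open import Data.Integer using (_+_; _*_; _-_; _^_)
  open ≡-Reasoning

  Σᶠ≡sum : ∀ {n} (f : Fin n → ℤ) → Σᶠ f ≡ sum f
  Σᶠ≡sum {zero} f = refl
  Σᶠ≡sum {suc n} f = cong (_+_ (f fzero)) (Σᶠ≡sum (f ∘ fsuc))

  sum-zero : ∀ {n} (f : Fin n → ℤ) → (∀ k → f k ≡ + 0) → sum f ≡ + 0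
  sum-zero {zero} f f≡0 = refl
  sum-zero {suc n} f f≡0 = cong₂ _+_ (f≡0 fzero) (sum-zero (f ∘ fsuc) (f≡0 ∘ fsuc))

  sum-last : ∀ n (g : ℕ → ℤ) → sum {suc n} (g ∘ toℕ) ≡ sum {n} (g ∘ toℕ) + g n
  sum-last zero g = ℤ.+-comm (g 0) (+ 0)
  sum-last (suc n) g = begin
    g 0 + sum {suc n} (g ∘ suc ∘ toℕ)           ≡⟨ cong (_+_ (g 0)) (sum-last n (g ∘ suc)) ⟩
    g 0 + (sum {n} (g ∘ suc ∘ toℕ) + g (suc n)) ≡⟨ sym (ℤ.+-assoc (g 0) _ (g (suc n))) ⟩
    g 0 + sum {n} (g ∘ suc ∘ toℕ) + g (suc n)   ∎

  sum-reverse : ∀ {n} (g : ℕ → ℤ) → sum {n} (g ∘ toℕ) ≡ sum {n} (λ k → g (n ∸ suc (toℕ k)))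
  sum-reverse {n} g = trans (∑-permute {n} (g ∘ toℕ) reverse) (sum-cong-≗ {n} (cong g ∘ opposite-prop))

  pascal-term : ∀ i l (t : ℤ) → + (suc i C suc l) * t ≡ + (i C l) * t + + (i C suc l) * t
  pascal-term i l t = begin
    + (suc i C suc l) * t             ≡⟨ cong (λ c → + c * t) (sym (nCk+nC[k+1]≡[n+1]C[k+1] i l)) ⟩
    + (i C l ℕ.+ i C suc l) * t       ≡⟨ ℤ.*-distribʳ-+ t (+ (i C l)) (+ (i C suc l)) ⟩
    + (i C l) * t + + (i C suc l) * t ∎

  binomialTerm : ℤ → ℤ → ℕ → ℕ → ℕ → ℤ
  binomialTerm x y i M l = + (i C l) * (x ^ l * y ^ (M ∸ l))

  padded-binomial : ∀ x y i r M → i ℕ.+ r ≡ M →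
    sum {suc M} (binomialTerm x y i M ∘ toℕ) ≡ y ^ r * (x + y) ^ i
  padded-binomial x y zero r .r refl = begin
    + 1 * (+ 1 * y ^ r) + sum {r} (λ l → + 0 * (x ^ suc (toℕ l) * y ^ (r ∸ suc (toℕ l))))
      ≡⟨ cong (_+_ (+ 1 * (+ 1 * y ^ r)))
              (sum-zero {r} _ (λ l → ℤ.*-zeroˡ (x ^ suc (toℕ l) * y ^ (r ∸ suc (toℕ l))))) ⟩
    + 1 * (+ 1 * y ^ r) + + 0 ≡⟨ simplify (y ^ r) ⟩
    y ^ r * + 1               ∎
    where simplify : ∀ a → + 1 * (+ 1 * a) + + 0 ≡ a * + 1
          simplify = solve-∀
  padded-binomial x y (suc i) r .(suc (i ℕ.+ r)) refl = begin
    t₀ + sum {M} (λ l → binomialTerm x y (suc i) M (suc (toℕ l)))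
      ≡⟨ cong (_+_ t₀) (trans (sum-cong-≗ {M} (split ∘ toℕ))
                               (∑-distrib-+ {M} (lower ∘ toℕ) (upper ∘ toℕ))) ⟩
    t₀ + (sum {M} (lower ∘ toℕ) + sum {M} (upper ∘ toℕ))
      ≡⟨ swap t₀ (sum {M} (lower ∘ toℕ)) (sum {M} (upper ∘ toℕ)) ⟩
    (t₀ + sum {M} (upper ∘ toℕ)) + sum {M} (lower ∘ toℕ)
      ≡⟨ cong₂ _+_ (padded-binomial x y i (suc r) M (ℕ.+-suc i r))
                   (sym (*-distribˡ-sum {M} x (binomialTerm x y i (i ℕ.+ r) ∘ toℕ))) ⟩
    y ^ suc r * (x + y) ^ i + x * sum {M} (binomialTerm x y i (i ℕ.+ r) ∘ toℕ)
      ≡⟨ cong (λ s → y ^ suc r * (x + y) ^ i + x * s) (padded-binomial x y i r (i ℕ.+ r) refl) ⟩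
    y ^ suc r * (x + y) ^ i + x * (y ^ r * (x + y) ^ i)
      ≡⟨ factor x y (y ^ r) ((x + y) ^ i) ⟩
    y ^ r * (x + y) ^ suc i ∎
    where
    M = suc (i ℕ.+ r)
    t₀ = + 1 * (+ 1 * y ^ M)
    lower upper : ℕ → ℤ
    lower l = x * binomialTerm x y i (i ℕ.+ r) l
    upper l = binomialTerm x y i M (suc l)
    split : ∀ l → binomialTerm x y (suc i) M (suc l) ≡ lower l + upper l
    split l = trans (pascal-term i l (x ^ suc l * y ^ (i ℕ.+ r ∸ l)))
                    (cong (_+ upper l) (pull (+ (i C l)) x (x ^ l) (y ^ (i ℕ.+ r ∸ l))))
      where pull : ∀ c x a b → c * (x * a * b) ≡ x * (c * (a * b))
            pull = solve-∀
    swap : ∀ a b c → a + (b + c) ≡ (a + c) + b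
    swap = solve-∀
    factor : ∀ x y a b → y * a * b + x * (a * b) ≡ a * ((x + y) * b)
    factor = solve-∀

  infixr 7 _*ᵥ_

  _*ᵥ_ : ∀ {n} → Mat n → (Fin n → ℤ) → Fin n → ℤ
  (A *ᵥ v) i = sum (λ k → A i k * v k)

  *ᵥ-cong : ∀ {n} (A : Mat n) {v w : Fin n → ℤ} → (∀ k → v k ≡ w k) → ∀ i → (A *ᵥ v) i ≡ (A *ᵥ w) i
  *ᵥ-cong {n} A v≗w i = sum-cong-≗ {n} (λ k → cong (A i k *_) (v≗w k))

  ⊗-*ᵥ : ∀ {n} (A B : Mat n) v i → ((A ⊗ B) *ᵥ v) i ≡ (A *ᵥ (B *ᵥ v)) i
  ⊗-*ᵥ {n} A B v i = begin
    sum (λ k → Σᶠ (λ l → A i l * B l k) * v k)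
      ≡⟨ sum-cong-≗ {n} (λ k → trans (cong (_* v k) (Σᶠ≡sum (λ l → A i l * B l k)))
                                     (*-distribʳ-sum {n} (v k) (λ l → A i l * B l k))) ⟩
    sum (λ k → sum (λ l → A i l * B l k * v k))
      ≡⟨ ∑-comm {n} {n} (λ k l → A i l * B l k * v k) ⟩
    sum (λ l → sum (λ k → A i l * B l k * v k))
      ≡⟨ sum-cong-≗ {n} (λ l → trans (sum-cong-≗ {n} (λ k → ℤ.*-assoc (A i l) (B l k) (v k)))
                                     (sym (*-distribˡ-sum {n} (A i l) (λ k → B l k * v k)))) ⟩
    sum (λ l → A i l * sum (λ k → B l k * v k)) ∎

  identity-*ᵥ : ∀ {n} (v : Fin n → ℤ) i → (identity n *ᵥ v) i ≡ v i
  identity-*ᵥ {suc n} v fzero = begin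
    + 1 * v fzero + sum (λ k → + 0 * v (fsuc k))
      ≡⟨ cong₂ _+_ (ℤ.*-identityˡ (v fzero)) (sum-zero {n} _ (λ k → ℤ.*-zeroˡ (v (fsuc k)))) ⟩
    v fzero + + 0 ≡⟨ ℤ.+-identityʳ (v fzero) ⟩
    v fzero       ∎
  identity-*ᵥ {suc n} v (fsuc i) = begin
    + 0 * v fzero + (identity n *ᵥ (v ∘ fsuc)) i ≡⟨ ℤ.+-identityˡ _ ⟩
    (identity n *ᵥ (v ∘ fsuc)) i                 ≡⟨ identity-*ᵥ (v ∘ fsuc) i ⟩
    v (fsuc i)                                   ∎

  monomials : ∀ n → ℤ → ℤ → Fin n → ℤ
  monomials n x y k = x ^ (n ∸ suc (toℕ k)) * y ^ toℕ k

  R-*ᵥ-monomials : ∀ n x y i → (R n *ᵥ monomials n x y) i ≡ monomials n y (x + y) i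
  R-*ᵥ-monomials (suc n) x y i = begin
    (R (suc n) *ᵥ monomials (suc n) x y) i
      ≡⟨ sum-cong-≗ {suc n} (λ k → cong (λ e → + (toℕ i C (n ∸ toℕ k)) * (x ^ (n ∸ toℕ k) * y ^ e))
                                         (sym (ℕ.m∸[m∸n]≡n (ℕ.≤-pred (toℕ<n k))))) ⟩
    sum {suc n} (λ k → binomialTerm x y (toℕ i) n (n ∸ toℕ k))
      ≡⟨ sym (sum-reverse {suc n} (binomialTerm x y (toℕ i) n)) ⟩
    sum {suc n} (binomialTerm x y (toℕ i) n ∘ toℕ)
      ≡⟨ padded-binomial x y (toℕ i) (n ∸ toℕ i) n (ℕ.m+[n∸m]≡n (ℕ.≤-pred (toℕ<n i))) ⟩
    monomials (suc n) y (x + y) i ∎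

  F : ℕ → ℤ
  F m = + fib m

  F-suc-suc : ∀ m → F (suc (suc m)) ≡ F (suc m) + F m
  F-suc-suc m = ℤ.pos-+ (fib (suc m)) (fib m)

  R^-*ᵥ-monomials : ∀ n m x y i →
    ((R n ^ᴹ suc m) *ᵥ monomials n x y) i
      ≡ monomials n (F m * x + F (suc m) * y) (F (suc m) * x + F (suc (suc m)) * y) i
  R^-*ᵥ-monomials n zero x y i = begin
    ((R n ⊗ identity n) *ᵥ monomials n x y) i  ≡⟨ ⊗-*ᵥ (R n) (identity n) (monomials n x y) i ⟩
    (R n *ᵥ (identity n *ᵥ monomials n x y)) i ≡⟨ *ᵥ-cong (R n) (identity-*ᵥ (monomials n x y)) i ⟩
    (R n *ᵥ monomials n x y) i                 ≡⟨ R-*ᵥ-monomials n x y i ⟩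
    monomials n y (x + y) i                    ≡⟨ cong₂ (λ a b → monomials n a b i) (first x y) (second x y) ⟩
    monomials n (+ 0 * x + + 1 * y) (+ 1 * x + + 1 * y) i ∎
    where first : ∀ x y → y ≡ + 0 * x + + 1 * y
          first = solve-∀
          second : ∀ x y → x + y ≡ + 1 * x + + 1 * y
          second = solve-∀
  R^-*ᵥ-monomials n (suc m) x y i = begin
    ((R n ⊗ (R n ^ᴹ suc m)) *ᵥ monomials n x y) i  ≡⟨ ⊗-*ᵥ (R n) (R n ^ᴹ suc m) (monomials n x y) i ⟩
    (R n *ᵥ ((R n ^ᴹ suc m) *ᵥ monomials n x y)) i ≡⟨ *ᵥ-cong (R n) (R^-*ᵥ-monomials n m x y) i ⟩
    (R n *ᵥ monomials n a b) i                     ≡⟨ R-*ᵥ-monomials n a b i ⟩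
    monomials n b (a + b) i                        ≡⟨ cong (λ c → monomials n b c i) a+b≡ ⟩
    monomials n b (F (suc (suc m)) * x + F (suc (suc (suc m))) * y) i ∎
    where
    a = F m * x + F (suc m) * y
    b = F (suc m) * x + F (suc (suc m)) * y
    a+b≡ : a + b ≡ F (suc (suc m)) * x + F (suc (suc (suc m))) * y
    a+b≡ rewrite F-suc-suc (suc m) | F-suc-suc m = regroup (F m) (F (suc m)) x y
      where regroup : ∀ f₀ f₁ x y → (f₀ * x + f₁ * y) + (f₁ * x + (f₁ + f₀) * y)
                                     ≡ (f₁ + f₀) * x + ((f₁ + f₀) + f₁) * y
            regroup = solve-∀

  eval : ∀ {n} → (Fin n → ℤ) → ℤ → ℤ
  eval {zero} c y = + 0
  eval {suc n} c y = c fzero + y * eval (c ∘ fsuc) y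

  sum≡eval : ∀ {n} (c : Fin n → ℤ) y → sum (λ k → c k * y ^ toℕ k) ≡ eval c y
  sum≡eval {zero} c y = refl
  sum≡eval {suc n} c y = begin
    c fzero * + 1 + sum (λ k → c (fsuc k) * (y * y ^ toℕ k))
      ≡⟨ cong₂ _+_ (ℤ.*-identityʳ (c fzero))
                   (trans (sum-cong-≗ {n} (λ k → swap (c (fsuc k)) y (y ^ toℕ k)))
                          (sym (*-distribˡ-sum {n} y (λ k → c (fsuc k) * y ^ toℕ k)))) ⟩
    c fzero + y * sum (λ k → c (fsuc k) * y ^ toℕ k)
      ≡⟨ cong (λ s → c fzero + y * s) (sum≡eval (c ∘ fsuc) y) ⟩
    eval c y ∎
    where swap : ∀ a y b → a * (y * b) ≡ y * (a * b)
          swap = solve-∀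

  eval-linear : ∀ {n} a b (f g : Fin n → ℤ) y → eval (λ k → a * f k + b * g k) y ≡ a * eval f y + b * eval g y
  eval-linear {zero} a b f g y = zeros a b
    where zeros : ∀ a b → + 0 ≡ a * + 0 + b * + 0
          zeros = solve-∀
  eval-linear {suc n} a b f g y =
    trans (cong (λ s → (a * f fzero + b * g fzero) + y * s) (eval-linear a b (f ∘ fsuc) (g ∘ fsuc) y))
          (regroup a b (f fzero) (g fzero) y (eval (f ∘ fsuc) y) (eval (g ∘ fsuc) y))
    where regroup : ∀ a b f₀ g₀ y F G →
                      (a * f₀ + b * g₀) + y * (a * F + b * G) ≡ a * (f₀ + y * F) + b * (g₀ + y * G)
          regroup = solve-∀

  eval-− : ∀ {n} (f g : Fin n → ℤ) y → eval (λ k → f k - g k) y ≡ eval f y - eval g y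
  eval-− {zero} f g y = refl
  eval-− {suc n} f g y =
    trans (cong (λ s → (f fzero - g fzero) + y * s) (eval-− (f ∘ fsuc) (g ∘ fsuc) y))
          (regroup (f fzero) (g fzero) y (eval (f ∘ fsuc) y) (eval (g ∘ fsuc) y))
    where regroup : ∀ f₀ g₀ y F G → (f₀ - g₀) + y * (F - G) ≡ (f₀ + y * F) - (g₀ + y * G)
          regroup = solve-∀

  divisible-by-all⇒0 : ∀ a → (∀ m → suc m ℕ.∣ a) → a ≡ 0
  divisible-by-all⇒0 zero _ = refl
  divisible-by-all⇒0 (suc a) divisible = contradiction (divisible (suc a)) (>⇒∤ ℕ.≤-refl)

  -- The constant term is divisible by every positive integer, hence zero; then recurse.
  coefficients-vanish : ∀ {n} (h : Fin n → ℤ) → (∀ m → eval h (+ suc m) ≡ + 0) → ∀ k → h k ≡ + 0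
  coefficients-vanish {suc n} h vanishes = vanish
    where
    rest : ℕ → ℤ
    rest m = eval (h ∘ fsuc) (+ suc m)

    h₀≡ : ∀ m → h fzero ≡ - rest m * + suc m
    h₀≡ m = begin
      h fzero                                           ≡⟨ isolate (h fzero) (+ suc m) (rest m) ⟩
      (h fzero + + suc m * rest m) + - rest m * + suc m ≡⟨ cong (_+ - rest m * + suc m) (vanishes m) ⟩
      + 0 + - rest m * + suc m                          ≡⟨ ℤ.+-identityˡ _ ⟩
      - rest m * + suc m                                ∎
      where isolate : ∀ a s r → a ≡ (a + s * r) + - r * s
            isolate = solve-∀

    h₀≡0 : h fzero ≡ + 0
    h₀≡0 = ℤ.∣i∣≡0⇒i≡0 (divisible-by-all⇒0 ∣ h fzero ∣ (λ m → ∣⇒∣ᵤ (divides (- rest m) (h₀≡ m))))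

    rest≡0 : ∀ m → rest m ≡ + 0
    rest≡0 m = ℤ.*-cancelˡ-≡ (+ suc m) (rest m) (+ 0) (begin
      + suc m * rest m           ≡⟨ sym (ℤ.+-identityˡ _) ⟩
      + 0 + + suc m * rest m     ≡⟨ cong (_+ + suc m * rest m) (sym h₀≡0) ⟩
      h fzero + + suc m * rest m ≡⟨ vanishes m ⟩
      + 0                        ≡⟨ sym (ℤ.*-zeroʳ (+ suc m)) ⟩
      + suc m * + 0              ∎)

    vanish : ∀ k → h k ≡ + 0
    vanish fzero = h₀≡0
    vanish (fsuc k) = coefficients-vanish (h ∘ fsuc) rest≡0 k

  -- Polynomials in y as coefficient sequences ℕ → ℤ: shift multiplies by y, mulLinear a b by a + b y,
  -- powLinear a b u by (a + b y) ^ u, and linearProduct a b c d u v is (a + b y) ^ u (c + d y) ^ v.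
  Degree≤ : ℕ → (ℕ → ℤ) → Set
  Degree≤ d c = ∀ j → d ℕ.< j → c j ≡ + 0

  monomial : ℕ → ℕ → ℤ
  monomial zero zero = + 1
  monomial zero (suc j) = + 0
  monomial (suc v) zero = + 0
  monomial (suc v) (suc j) = monomial v j

  shift : (ℕ → ℤ) → ℕ → ℤ
  shift c zero = + 0
  shift c (suc j) = c j

  mulLinear : ℤ → ℤ → (ℕ → ℤ) → ℕ → ℤ
  mulLinear a b c j = a * c j + b * shift c j

  powLinear : ℤ → ℤ → ℕ → (ℕ → ℤ) → ℕ → ℤ
  powLinear a b zero c = c
  powLinear a b (suc u) c = mulLinear a b (powLinear a b u c)

  linearProduct : ℤ → ℤ → ℤ → ℤ → ℕ → ℕ → ℕ → ℤ
  linearProduct a b c d u v = powLinear a b u (powLinear c d v (monomial 0))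

  monomial-zero-degree : Degree≤ 0 (monomial 0)
  monomial-zero-degree (suc j) _ = refl

  mulLinear-degree : ∀ a b {d c} → Degree≤ d c → Degree≤ (suc d) (mulLinear a b c)
  mulLinear-degree a b {d} {c} deg (suc j) (s≤s d<j) = begin
    a * c (suc j) + b * c j ≡⟨ cong₂ (λ s t → a * s + b * t) (deg (suc j) (ℕ.m<n⇒m<1+n d<j)) (deg j d<j) ⟩
    a * + 0 + b * + 0       ≡⟨ zeros a b ⟩
    + 0                     ∎
    where zeros : ∀ a b → a * + 0 + b * + 0 ≡ + 0
          zeros = solve-∀

  powLinear-degree : ∀ a b u {d c} → Degree≤ d c → Degree≤ (u ℕ.+ d) (powLinear a b u c)
  powLinear-degree a b zero deg = deg
  powLinear-degree a b (suc u) deg = mulLinear-degree a b (powLinear-degree a b u deg)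

  eval-drop-top : ∀ n (c : ℕ → ℤ) y → c n ≡ + 0 → eval {suc n} (c ∘ toℕ) y ≡ eval {n} (c ∘ toℕ) y
  eval-drop-top zero c y c₀≡0 = cong₂ _+_ c₀≡0 (ℤ.*-zeroʳ y)
  eval-drop-top (suc n) c y cₙ≡0 = cong (λ s → c 0 + y * s) (eval-drop-top n (c ∘ suc) y cₙ≡0)

  eval-mulLinear : ∀ a b {d} {c : ℕ → ℤ} y → Degree≤ d c →
    eval {suc (suc d)} (mulLinear a b c ∘ toℕ) y ≡ (a + b * y) * eval {suc d} (c ∘ toℕ) y
  eval-mulLinear a b {d} {c} y deg = begin
    eval {suc (suc d)} (mulLinear a b c ∘ toℕ) y
      ≡⟨ eval-linear {suc (suc d)} a b (c ∘ toℕ) (shift c ∘ toℕ) y ⟩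
    a * eval {suc (suc d)} (c ∘ toℕ) y + b * (+ 0 + y * e)
      ≡⟨ cong₂ (λ s t → a * s + b * t) (eval-drop-top (suc d) c y (deg (suc d) ℕ.≤-refl)) (ℤ.+-identityˡ _) ⟩
    a * e + b * (y * e) ≡⟨ factor a b y e ⟩
    (a + b * y) * e     ∎
    where
    e = eval {suc d} (c ∘ toℕ) y
    factor : ∀ a b y e → a * e + b * (y * e) ≡ (a + b * y) * e
    factor = solve-∀

  eval-powLinear : ∀ a b u {d N} {c : ℕ → ℤ} y → Degree≤ d c → u ℕ.+ d ≡ N →
    eval {suc N} (powLinear a b u c ∘ toℕ) y ≡ (a + b * y) ^ u * eval {suc d} (c ∘ toℕ) y
  eval-powLinear a b zero y deg refl = sym (ℤ.*-identityˡ _)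
  eval-powLinear a b (suc u) {d} {c = c} y deg refl = begin
    eval {suc (suc (u ℕ.+ d))} (powLinear a b (suc u) c ∘ toℕ) y
      ≡⟨ eval-mulLinear a b y (powLinear-degree a b u deg) ⟩
    (a + b * y) * eval {suc (u ℕ.+ d)} (powLinear a b u c ∘ toℕ) y
      ≡⟨ cong ((a + b * y) *_) (eval-powLinear a b u y deg refl) ⟩
    (a + b * y) * ((a + b * y) ^ u * eval {suc d} (c ∘ toℕ) y)
      ≡⟨ sym (ℤ.*-assoc (a + b * y) ((a + b * y) ^ u) _) ⟩
    (a + b * y) ^ suc u * eval {suc d} (c ∘ toℕ) y ∎

  eval-linearProduct : ∀ a b c d u v {N} y → u ℕ.+ v ≡ N →
    eval {suc N} (linearProduct a b c d u v ∘ toℕ) y ≡ (a + b * y) ^ u * (c + d * y) ^ v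
  eval-linearProduct a b c d u v {N} y u+v≡N = begin
    eval {suc N} (linearProduct a b c d u v ∘ toℕ) y
      ≡⟨ eval-powLinear a b u y inner-degree u+v≡N ⟩
    (a + b * y) ^ u * eval {suc v} (inner ∘ toℕ) y
      ≡⟨ cong ((a + b * y) ^ u *_) (eval-powLinear c d v y monomial-zero-degree (ℕ.+-identityʳ v)) ⟩
    (a + b * y) ^ u * ((c + d * y) ^ v * (+ 1 + y * + 0))
      ≡⟨ unit ((a + b * y) ^ u) ((c + d * y) ^ v) y ⟩
    (a + b * y) ^ u * (c + d * y) ^ v ∎
    where
    inner = powLinear c d v (monomial 0)
    inner-degree : Degree≤ v inner
    inner-degree = subst (λ e → Degree≤ e inner) (ℕ.+-identityʳ v) (powLinear-degree c d v monomial-zero-degree)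
    unit : ∀ A C y → A * (C * (+ 1 + y * + 0)) ≡ A * C
    unit = solve-∀

  powLinear-negate : ∀ u (c : ℕ → ℤ) j → powLinear -1ℤ (+ 0) u c j ≡ -1ℤ ^ u * c j
  powLinear-negate zero c j = sym (ℤ.*-identityˡ (c j))
  powLinear-negate (suc u) c j =
    trans (cong (λ s → -1ℤ * s + + 0 * t) (powLinear-negate u c j)) (drop (-1ℤ ^ u) (c j) t)
    where
    t = shift (powLinear -1ℤ (+ 0) u c) j
    drop : ∀ s c t → -1ℤ * (s * c) + + 0 * t ≡ -1ℤ * s * c
    drop = solve-∀

  powLinear-negate-shift : ∀ v j → powLinear (+ 0) -1ℤ v (monomial 0) j ≡ -1ℤ ^ v * monomial v j
  powLinear-negate-shift zero j = sym (ℤ.*-identityˡ (monomial 0 j))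
  powLinear-negate-shift (suc v) zero = zeros (powLinear (+ 0) -1ℤ v (monomial 0) 0) (-1ℤ ^ v)
    where zeros : ∀ c s → + 0 * c + -1ℤ * + 0 ≡ -1ℤ * s * + 0
          zeros = solve-∀
  powLinear-negate-shift (suc v) (suc j) =
    trans (cong (λ s → + 0 * t + -1ℤ * s) (powLinear-negate-shift v j)) (drop t (-1ℤ ^ v) (monomial v j))
    where
    t = powLinear (+ 0) -1ℤ v (monomial 0) (suc j)
    drop : ∀ t s m → + 0 * t + -1ℤ * (s * m) ≡ -1ℤ * s * m
    drop = solve-∀

  linearProduct-negate : ∀ u v j → linearProduct -1ℤ (+ 0) (+ 0) -1ℤ u v j ≡ -1ℤ ^ (u ℕ.+ v) * monomial v j
  linearProduct-negate u v j = begin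
    powLinear -1ℤ (+ 0) u (powLinear (+ 0) -1ℤ v (monomial 0)) j
      ≡⟨ powLinear-negate u _ j ⟩
    -1ℤ ^ u * powLinear (+ 0) -1ℤ v (monomial 0) j
      ≡⟨ cong (-1ℤ ^ u *_) (powLinear-negate-shift v j) ⟩
    -1ℤ ^ u * (-1ℤ ^ v * monomial v j)
      ≡⟨ sym (ℤ.*-assoc (-1ℤ ^ u) (-1ℤ ^ v) (monomial v j)) ⟩
    -1ℤ ^ u * -1ℤ ^ v * monomial v j
      ≡⟨ cong (_* monomial v j) (sym (ℤ.^-distribˡ-+-* -1ℤ u v)) ⟩
    -1ℤ ^ (u ℕ.+ v) * monomial v j ∎

  identity≡monomial : ∀ {n} (i k : Fin n) → identity n i k ≡ monomial (toℕ i) (toℕ k)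
  identity≡monomial fzero fzero = refl
  identity≡monomial fzero (fsuc k) = refl
  identity≡monomial (fsuc i) fzero = refl
  identity≡monomial (fsuc i) (fsuc k) = identity≡monomial i k

  eval-R^-row : ∀ n m (i : Fin n) y →
    eval ((R n ^ᴹ suc m) i) y
      ≡ (F m + F (suc m) * y) ^ (n ∸ suc (toℕ i)) * (F (suc m) + F (suc (suc m)) * y) ^ toℕ i
  eval-R^-row n m i y = begin
    eval ((R n ^ᴹ suc m) i) y
      ≡⟨ sym (sum≡eval ((R n ^ᴹ suc m) i) y) ⟩
    sum (λ k → (R n ^ᴹ suc m) i k * y ^ toℕ k)
      ≡⟨ sum-cong-≗ {n} (λ k → cong ((R n ^ᴹ suc m) i k *_) (one-power (n ∸ suc (toℕ k)) (y ^ toℕ k))) ⟩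
    ((R n ^ᴹ suc m) *ᵥ monomials n (+ 1) y) i
      ≡⟨ R^-*ᵥ-monomials n m (+ 1) y i ⟩
    monomials n (F m * + 1 + F (suc m) * y) (F (suc m) * + 1 + F (suc (suc m)) * y) i
      ≡⟨ cong₂ (λ a b → monomials n a b i) (unit (F m) (F (suc m)) y) (unit (F (suc m)) (F (suc (suc m))) y) ⟩
    (F m + F (suc m) * y) ^ (n ∸ suc (toℕ i)) * (F (suc m) + F (suc (suc m)) * y) ^ toℕ i ∎
    where
    one-power : ∀ e a → a ≡ (+ 1) ^ e * a
    one-power e a = trans (sym (ℤ.*-identityˡ a)) (cong (_* a) (sym (ℤ.^-zeroˡ e)))
    unit : ∀ a b y → a * + 1 + b * y ≡ a + b * y
    unit = solve-∀

  R^-entry : ∀ n m (i k : Fin (suc n)) →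
    (R (suc n) ^ᴹ suc m) i k
      ≡ linearProduct (F m) (F (suc m)) (F (suc m)) (F (suc (suc m))) (n ∸ toℕ i) (toℕ i) (toℕ k)
  R^-entry n m i k = ℤ.i-j≡0⇒i≡j _ _ (coefficients-vanish (λ k → E k - c (toℕ k)) difference-vanishes k)
    where
    E : Fin (suc n) → ℤ
    E = (R (suc n) ^ᴹ suc m) i
    c : ℕ → ℤ
    c = linearProduct (F m) (F (suc m)) (F (suc m)) (F (suc (suc m))) (n ∸ toℕ i) (toℕ i)
    difference-vanishes : ∀ y → eval (λ k → E k - c (toℕ k)) (+ suc y) ≡ + 0
    difference-vanishes y = begin
      eval (λ k → E k - c (toℕ k)) (+ suc y)              ≡⟨ eval-− {suc n} E (c ∘ toℕ) (+ suc y) ⟩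
      eval E (+ suc y) - eval {suc n} (c ∘ toℕ) (+ suc y)
        ≡⟨ cong₂ _-_ (eval-R^-row (suc n) m i (+ suc y))
                     (eval-linearProduct _ _ _ _ (n ∸ toℕ i) (toℕ i) (+ suc y)
                                         (ℕ.m∸n+n≡m (ℕ.≤-pred (toℕ<n i)))) ⟩
      P - P                                                ≡⟨ ℤ.+-inverseʳ P ⟩
      + 0                                                  ∎
      where P = (F m + F (suc m) * + suc y) ^ (n ∸ toℕ i) * (F (suc m) + F (suc (suc m)) * + suc y) ^ toℕ i

  binomialSum : ℕ → (ℕ → ℤ) → ℤ
  binomialSum n f = sum {suc n} (λ j → + (n C toℕ j) * f (toℕ j))

  binomialSum-pascal : ∀ n f → binomialSum (suc n) f ≡ binomialSum n f + binomialSum n (f ∘ suc)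
  binomialSum-pascal n f = begin
    t₀ + sum {suc n} (λ j → + (suc n C suc (toℕ j)) * f (suc (toℕ j)))
      ≡⟨ cong (_+_ t₀) (trans (sum-cong-≗ {suc n} (λ j → pascal-term n (toℕ j) (f (suc (toℕ j)))))
                               (∑-distrib-+ {suc n} (λ j → + (n C toℕ j) * f (suc (toℕ j))) (upper ∘ toℕ))) ⟩
    t₀ + (binomialSum n (f ∘ suc) + sum {suc n} (upper ∘ toℕ))
      ≡⟨ cong (λ s → t₀ + (binomialSum n (f ∘ suc) + s)) (sum-last n upper) ⟩
    t₀ + (binomialSum n (f ∘ suc) + (sum {n} (upper ∘ toℕ) + + (n C suc n) * f (suc n)))
      ≡⟨ cong (λ c → t₀ + (binomialSum n (f ∘ suc) + (sum {n} (upper ∘ toℕ) + + c * f (suc n))))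
              (k>n⇒nCk≡0 (ℕ.n<1+n n)) ⟩
    t₀ + (binomialSum n (f ∘ suc) + (sum {n} (upper ∘ toℕ) + + 0 * f (suc n)))
      ≡⟨ regroup t₀ (binomialSum n (f ∘ suc)) (sum {n} (upper ∘ toℕ)) (f (suc n)) ⟩
    (t₀ + sum {n} (upper ∘ toℕ)) + binomialSum n (f ∘ suc) ∎
    where
    t₀ = + 1 * f 0
    upper : ℕ → ℤ
    upper j = + (n C suc j) * f (suc j)
    regroup : ∀ a b c x → a + (b + (c + + 0 * x)) ≡ (a + c) + b
    regroup = solve-∀

  binomialSum-*ˡ : ∀ n a f → binomialSum n (λ j → a * f j) ≡ a * binomialSum n f
  binomialSum-*ˡ n a f = trans (sum-cong-≗ {suc n} (λ j → swap (+ (n C toℕ j)) a (f (toℕ j))))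
                               (sym (*-distribˡ-sum {suc n} a (λ j → + (n C toℕ j) * f (toℕ j))))
    where swap : ∀ c a x → c * (a * x) ≡ a * (c * x)
          swap = solve-∀

  binomialSum-ones : ∀ n → binomialSum n (λ _ → + 1) ≡ (+ 2) ^ n
  binomialSum-ones zero = refl
  binomialSum-ones (suc n) = begin
    binomialSum (suc n) (λ _ → + 1)                       ≡⟨ binomialSum-pascal n (λ _ → + 1) ⟩
    binomialSum n (λ _ → + 1) + binomialSum n (λ _ → + 1) ≡⟨ cong₂ _+_ (binomialSum-ones n) (binomialSum-ones n) ⟩
    (+ 2) ^ n + (+ 2) ^ n                                 ≡⟨ double ((+ 2) ^ n) ⟩
    (+ 2) ^ suc n                                         ∎
    where double : ∀ t → t + t ≡ + 2 * t
          double = solve-∀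

  -- (√5) ^ j = √5^₀ j + √5^₁ j √5
  √5^₀ √5^₁ : ℕ → ℤ
  √5^₀ zero = + 1
  √5^₀ (suc j) = + 5 * √5^₁ j
  √5^₁ zero = + 0
  √5^₁ (suc j) = √5^₀ j

  √5^₁-even : ∀ m → √5^₁ (2 ℕ.* m) ≡ + 0
  √5^₁-even zero = refl
  √5^₁-even (suc m) rewrite ℕ.+-suc m (m ℕ.+ 0) =
    trans (cong (λ s → + 5 * s) (√5^₁-even m)) (ℤ.*-zeroʳ (+ 5))

  -- (1 + √5) ^ n = H n + G n √5
  G H : ℕ → ℤ
  G n = binomialSum n √5^₁
  H n = binomialSum n √5^₀

  G-H-fib : ∀ n → (+ 2 * G n ≡ (+ 2) ^ n * F n) × (+ 2 * H n ≡ (+ 2) ^ n * (+ 2 * F (suc n) - F n))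
  G-H-fib zero = refl , refl
  G-H-fib (suc n) = 2G , 2H
    where
    T = (+ 2) ^ n
    2G : + 2 * G (suc n) ≡ (+ 2) ^ suc n * F (suc n)
    2G = begin
      + 2 * G (suc n)                       ≡⟨ cong (λ s → + 2 * s) (binomialSum-pascal n √5^₁) ⟩
      + 2 * (G n + H n)                     ≡⟨ ℤ.*-distribˡ-+ (+ 2) (G n) (H n) ⟩
      + 2 * G n + + 2 * H n                 ≡⟨ cong₂ _+_ (proj₁ (G-H-fib n)) (proj₂ (G-H-fib n)) ⟩
      T * F n + T * (+ 2 * F (suc n) - F n) ≡⟨ combine T (F n) (F (suc n)) ⟩
      + 2 * T * F (suc n)                   ∎
      where combine : ∀ T f₀ f₁ → T * f₀ + T * (+ 2 * f₁ - f₀) ≡ + 2 * T * f₁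
            combine = solve-∀
    2H : + 2 * H (suc n) ≡ (+ 2) ^ suc n * (+ 2 * F (suc (suc n)) - F (suc n))
    2H = begin
      + 2 * H (suc n)
        ≡⟨ cong (λ s → + 2 * s) (trans (binomialSum-pascal n √5^₀)
                                       (cong (_+_ (H n)) (binomialSum-*ˡ n (+ 5) √5^₁))) ⟩
      + 2 * (H n + + 5 * G n)
        ≡⟨ distribute (H n) (G n) ⟩
      + 2 * H n + + 5 * (+ 2 * G n)
        ≡⟨ cong₂ (λ h g → h + + 5 * g) (proj₂ (G-H-fib n)) (proj₁ (G-H-fib n)) ⟩
      T * (+ 2 * F (suc n) - F n) + + 5 * (T * F n)
        ≡⟨ combine T (F n) (F (suc n)) ⟩
      + 2 * T * (+ 2 * (F (suc n) + F n) - F (suc n))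
        ≡⟨ cong (λ f → + 2 * T * (+ 2 * f - F (suc n))) (sym (F-suc-suc n)) ⟩
      + 2 * T * (+ 2 * F (suc (suc n)) - F (suc n)) ∎
      where distribute : ∀ h g → + 2 * (h + + 5 * g) ≡ + 2 * h + + 5 * (+ 2 * g)
            distribute = solve-∀
            combine : ∀ T f₀ f₁ → T * (+ 2 * f₁ - f₀) + + 5 * (T * f₀) ≡ + 2 * T * (+ 2 * (f₁ + f₀) - f₁)
            combine = solve-∀

  -1^-even : ∀ k → -1ℤ ^ (2 ℕ.* k) ≡ + 1
  -1^-even k = trans (sym (ℤ.^-*-assoc -1ℤ 2 k)) (ℤ.^-zeroˡ k)

prime>1 : ∀ {p} → Prime p → 1 ℕ.< p
prime>1 {p} p-prime = ℕ.nonTrivial⇒n>1 p {{prime⇒nonTrivial p-prime}}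

prime∤factorial : ∀ {p} → Prime p → ∀ m → m ℕ.< p → ¬ p ℕ.∣ m !
prime∤factorial p-prime zero _ = >⇒∤ (prime>1 p-prime)
prime∤factorial p-prime (suc m) m<p p∣m! with euclidsLemma (suc m) (m !) p-prime p∣m!
... | inj₁ p∣1+m = >⇒∤ m<p p∣1+m
... | inj₂ p∣m! = prime∤factorial p-prime m (ℕ.<-trans (ℕ.n<1+n m) m<p) p∣m!

-- p divides p ! = (p C k) * k ! * (p - k) ! but neither k ! nor (p - k) !.
prime∣binomial : ∀ {p k} → Prime p → 0 ℕ.< k → k ℕ.< p → p ℕ.∣ p C k
prime∣binomial {suc p′} {suc k′} p-prime _ k<p
  with euclidsLemma (suc p′ C suc k′) (suc k′ ! ℕ.* (p′ ∸ k′) !) p-prime p∣C*D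
  where
  instance _ = suc k′ !* (p′ ∸ k′) !≢0
  C*D≡p! : (suc p′ C suc k′) ℕ.* (suc k′ ! ℕ.* (p′ ∸ k′) !) ≡ suc p′ !
  C*D≡p! = trans (cong (ℕ._* (suc k′ ! ℕ.* (p′ ∸ k′) !)) (nCk≡n!/k![n-k]! (ℕ.<⇒≤ k<p)))
                 (m/n*n≡m (k![n∸k]!∣n! (ℕ.<⇒≤ k<p)))
  p∣C*D : suc p′ ℕ.∣ (suc p′ C suc k′) ℕ.* (suc k′ ! ℕ.* (p′ ∸ k′) !)
  p∣C*D = subst (suc p′ ℕ.∣_) (sym C*D≡p!) (ℕ.m∣m*n (p′ !))
... | inj₁ p∣C = p∣C
... | inj₂ p∣D with euclidsLemma (suc k′ !) ((p′ ∸ k′) !) p-prime p∣D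
...   | inj₁ p∣k! = contradiction p∣k! (prime∤factorial p-prime (suc k′) k<p)
...   | inj₂ p∣[p-k]! = contradiction p∣[p-k]! (prime∤factorial p-prime (p′ ∸ k′) (s≤s (ℕ.m∸n≤m p′ k′)))

even-or-odd : ∀ n → ∃[ m ] (n ≡ 2 ℕ.* m ⊎ n ≡ suc (2 ℕ.* m))
even-or-odd zero = 0 , inj₁ refl
even-or-odd (suc n) with even-or-odd n
... | m , inj₁ n≡2m = m , inj₂ (cong suc n≡2m)
... | m , inj₂ n≡1+2m = suc m , inj₁ (trans (cong suc n≡1+2m) (sym (ℕ.*-suc 2 m)))

odd-prime : ∀ {p} → Prime p → p ≢ 2 → ∃[ m ] p ≡ suc (2 ℕ.* m)
odd-prime {p} p-prime p≢2 with even-or-odd p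
... | m , inj₂ p≡1+2m = m , p≡1+2m
... | m , inj₁ p≡2m with prime⇒irreducible p-prime (ℕ.divides m (trans p≡2m (ℕ.*-comm 2 m)))
...   | inj₁ ()
...   | inj₂ 2≡p = contradiction (sym 2≡p) p≢2

module _ where

  open import Data.Integer using (_+_; _*_; _-_; _^_)
  open import Data.Integer.Divisibility using (_∣_)

  infix 4 _≈_[mod_]

  record _≈_[mod_] (a b : ℤ) (p : ℕ) : Set where
    constructor divides-difference
    field ∣difference : + p ∣ a - b

  open _≈_[mod_] public

  module _ {p : ℕ} where

    private
      from-signed : ∀ {x a b} → x ≡ a - b → + p Signed.∣ x → a ≈ b [mod p ]
      from-signed x≡a-b p∣x = divides-difference (∣⇒∣ᵤ (subst (+ p Signed.∣_) x≡a-b p∣x))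

      to-signed : ∀ {a b} → a ≈ b [mod p ] → + p Signed.∣ a - b
      to-signed a≈b = ∣ᵤ⇒∣ (∣difference a≈b)

    ≈-reflexive : ∀ {a b} → a ≡ b → a ≈ b [mod p ]
    ≈-reflexive {a} refl = from-signed (sym (ℤ.+-inverseʳ a)) (Signed.divides (+ 0) refl)

    ≈-refl : ∀ {a} → a ≈ a [mod p ]
    ≈-refl = ≈-reflexive refl

    ≈-sym : ∀ {a b} → a ≈ b [mod p ] → b ≈ a [mod p ]
    ≈-sym {a} {b} a≈b = from-signed (eq a b) (Signed.∣m⇒∣-m (to-signed a≈b))
      where eq : ∀ a b → - (a - b) ≡ b - a
            eq = solve-∀

    ≈-trans : ∀ {a b c} → a ≈ b [mod p ] → b ≈ c [mod p ] → a ≈ c [mod p ]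
    ≈-trans {a} {b} {c} a≈b b≈c = from-signed (eq a b c) (Signed.∣m∣n⇒∣m+n (to-signed a≈b) (to-signed b≈c))
      where eq : ∀ a b c → (a - b) + (b - c) ≡ a - c
            eq = solve-∀

    +-cong : ∀ {a b c d} → a ≈ b [mod p ] → c ≈ d [mod p ] → a + c ≈ b + d [mod p ]
    +-cong {a} {b} {c} {d} a≈b c≈d = from-signed (eq a b c d) (Signed.∣m∣n⇒∣m+n (to-signed a≈b) (to-signed c≈d))
      where eq : ∀ a b c d → (a - b) + (c - d) ≡ (a + c) - (b + d)
            eq = solve-∀

    *-cong : ∀ {a b c d} → a ≈ b [mod p ] → c ≈ d [mod p ] → a * c ≈ b * d [mod p ]
    *-cong {a} {b} {c} {d} a≈b c≈d = from-signed (eq a b c d)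
      (Signed.∣m∣n⇒∣m+n (Signed.∣n⇒∣m*n c (to-signed a≈b)) (Signed.∣n⇒∣m*n b (to-signed c≈d)))
      where eq : ∀ a b c d → c * (a - b) + b * (c - d) ≡ a * c - b * d
            eq = solve-∀

    *-congˡ : ∀ c {a b} → a ≈ b [mod p ] → c * a ≈ c * b [mod p ]
    *-congˡ c = *-cong (≈-refl {c})

    *-congʳ : ∀ c {a b} → a ≈ b [mod p ] → a * c ≈ b * c [mod p ]
    *-congʳ c a≈b = *-cong a≈b (≈-refl {c})

    multiple≈0 : ∀ q → q * + p ≈ + 0 [mod p ]
    multiple≈0 q = from-signed (eq q (+ p)) (Signed.divides q refl)
      where eq : ∀ q p → q * p ≡ q * p - + 0
            eq = solve-∀

  ≈-setoid : ℕ → Setoid _ _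
  ≈-setoid p = record
    { Carrier = ℤ
    ; _≈_ = _≈_[mod p ]
    ; isEquivalence = record { refl = ≈-refl ; sym = ≈-sym ; trans = ≈-trans }
    }

  module ≈-Reasoning {p : ℕ} = SetoidReasoning (≈-setoid p)
  open ≈-Reasoning

  ∣⇒≈0 : ∀ {q n} → q ℕ.∣ n → + n ≈ + 0 [mod q ]
  ∣⇒≈0 {q} (ℕ.divides c n≡c*q) = begin
    + _         ≡⟨ cong +_ n≡c*q ⟩
    + (c ℕ.* q) ≡⟨ ℤ.pos-* c q ⟩
    + c * + q   ≈⟨ multiple≈0 (+ c) ⟩
    + 0         ∎

  sum-≈0 : ∀ {q n} (f : Fin n → ℤ) → (∀ k → f k ≈ + 0 [mod q ]) → sum f ≈ + 0 [mod q ]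
  sum-≈0 {n = zero} f f≈0 = ≈-refl
  sum-≈0 {n = suc n} f f≈0 = +-cong (f≈0 fzero) (sum-≈0 (f ∘ fsuc) (f≈0 ∘ fsuc))

  module _ {q : ℕ} where

    mulLinear-cong : ∀ {a a′ b b′} {c c′ : ℕ → ℤ} → a ≈ a′ [mod q ] → b ≈ b′ [mod q ] →
      (∀ j → c j ≈ c′ j [mod q ]) → ∀ j → mulLinear a b c j ≈ mulLinear a′ b′ c′ j [mod q ]
    mulLinear-cong {c = c} {c′} a≈ b≈ c≈ j = +-cong (*-cong a≈ (c≈ j)) (*-cong b≈ (shift-cong j))
      where shift-cong : ∀ j → shift c j ≈ shift c′ j [mod q ]
            shift-cong zero = ≈-refl
            shift-cong (suc j) = c≈ j

    powLinear-cong : ∀ {a a′ b b′} u {c c′ : ℕ → ℤ} → a ≈ a′ [mod q ] → b ≈ b′ [mod q ] →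
      (∀ j → c j ≈ c′ j [mod q ]) → ∀ j → powLinear a b u c j ≈ powLinear a′ b′ u c′ j [mod q ]
    powLinear-cong zero a≈ b≈ c≈ = c≈
    powLinear-cong (suc u) a≈ b≈ c≈ = mulLinear-cong a≈ b≈ (powLinear-cong u a≈ b≈ c≈)

    linearProduct-≈ : ∀ {a b c d} u v → a ≈ -1ℤ [mod q ] → b ≈ + 0 [mod q ] → c ≈ + 0 [mod q ] →
      d ≈ -1ℤ [mod q ] → ∀ j → linearProduct a b c d u v j ≈ -1ℤ ^ (u ℕ.+ v) * monomial v j [mod q ]
    linearProduct-≈ {a} {b} {c} {d} u v a≈ b≈ c≈ d≈ j = begin
      linearProduct a b c d u v j
        ≈⟨ powLinear-cong u a≈ b≈ (powLinear-cong v c≈ d≈ (λ _ → ≈-refl)) j ⟩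
      linearProduct -1ℤ (+ 0) (+ 0) -1ℤ u v j ≡⟨ linearProduct-negate u v j ⟩
      -1ℤ ^ (u ℕ.+ v) * monomial v j          ∎

    R^-≈±identity : ∀ n m → F m ≈ -1ℤ [mod q ] → F (suc m) ≈ + 0 [mod q ] →
      ∀ i k → (R (suc n) ^ᴹ suc m) i k ≈ -1ℤ ^ n * identity (suc n) i k [mod q ]
    R^-≈±identity n m F[m]≈-1 F[m+1]≈0 i k = begin
      (R (suc n) ^ᴹ suc m) i k
        ≡⟨ R^-entry n m i k ⟩
      linearProduct (F m) (F (suc m)) (F (suc m)) (F (suc (suc m))) (n ∸ toℕ i) (toℕ i) (toℕ k)
        ≈⟨ linearProduct-≈ (n ∸ toℕ i) (toℕ i) F[m]≈-1 F[m+1]≈0 F[m+1]≈0 F[m+2]≈-1 (toℕ k) ⟩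
      -1ℤ ^ (n ∸ toℕ i ℕ.+ toℕ i) * monomial (toℕ i) (toℕ k)
        ≡⟨ cong₂ (λ e m → -1ℤ ^ e * m) (ℕ.m∸n+n≡m (ℕ.≤-pred (toℕ<n i))) (sym (identity≡monomial i k)) ⟩
      -1ℤ ^ n * identity (suc n) i k ∎
      where
      F[m+2]≈-1 : F (suc (suc m)) ≈ -1ℤ [mod q ]
      F[m+2]≈-1 = ≈-trans (≈-reflexive (F-suc-suc m)) (+-cong F[m+1]≈0 F[m]≈-1)

    R^-≈identity-odd : ∀ m → F m ≈ -1ℤ [mod q ] → F (suc m) ≈ + 0 [mod q ] →
      ∀ k → (R (suc (2 ℕ.* k)) ^ᴹ suc m) ≡ᴹ identity (suc (2 ℕ.* k)) [mod q ]
    R^-≈identity-odd m F[m]≈-1 F[m+1]≈0 k i j = ∣difference (begin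
      (R n ^ᴹ suc m) i j               ≈⟨ R^-≈±identity (2 ℕ.* k) m F[m]≈-1 F[m+1]≈0 i j ⟩
      -1ℤ ^ (2 ℕ.* k) * identity n i j ≡⟨ cong (_* identity n i j) (-1^-even k) ⟩
      + 1 * identity n i j             ≡⟨ ℤ.*-identityˡ (identity n i j) ⟩
      identity n i j                   ∎)
      where n = suc (2 ℕ.* k)

    R^-≈negM-even : ∀ m → F m ≈ -1ℤ [mod q ] → F (suc m) ≈ + 0 [mod q ] →
      ∀ k → (R (2 ℕ.* suc k) ^ᴹ suc m) ≡ᴹ negM (identity (2 ℕ.* suc k)) [mod q ]
    R^-≈negM-even m F[m]≈-1 F[m+1]≈0 k i j = ∣difference (begin
      (R n ^ᴹ suc m) i j
        ≈⟨ R^-≈±identity (k ℕ.+ suc (k ℕ.+ 0)) m F[m]≈-1 F[m+1]≈0 i j ⟩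
      -1ℤ ^ (k ℕ.+ suc (k ℕ.+ 0)) * identity n i j
        ≡⟨ cong (λ e → -1ℤ ^ e * identity n i j) (ℕ.+-suc k (k ℕ.+ 0)) ⟩
      -1ℤ * -1ℤ ^ (2 ℕ.* k) * identity n i j
        ≡⟨ cong (λ s → -1ℤ * s * identity n i j) (-1^-even k) ⟩
      -1ℤ * + 1 * identity n i j
        ≡⟨ ℤ.-1*i≡-i (identity n i j) ⟩
      - identity n i j ∎)
      where n = 2 ℕ.* suc k

  binomialSum-prime : ∀ {p} → Prime p → ∀ f → binomialSum p f ≈ f 0 + f p [mod p ]
  binomialSum-prime {p@(suc (suc p′))} p-prime f = begin
    + 1 * f 0 + sum {suc (suc p′)} (upper ∘ toℕ)
      ≡⟨ cong₂ _+_ (ℤ.*-identityˡ (f 0)) (sum-last (suc p′) upper) ⟩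
    f 0 + (sum {suc p′} (upper ∘ toℕ) + + (p C p) * f p)
      ≈⟨ +-cong (≈-refl {a = f 0}) (+-cong (sum-≈0 (upper ∘ toℕ) inner≈0)
                                           (≈-reflexive (cong (λ c → + c * f p) (nCn≡1 p)))) ⟩
    f 0 + (+ 0 + + 1 * f p)
      ≡⟨ cong (_+_ (f 0)) (trans (ℤ.+-identityˡ _) (ℤ.*-identityˡ (f p))) ⟩
    f 0 + f p ∎
    where
    upper : ℕ → ℤ
    upper j = + (p C suc j) * f (suc j)
    inner≈0 : ∀ j → upper (toℕ j) ≈ + 0 [mod p ]
    inner≈0 j = begin
      + (p C suc (toℕ j)) * f (suc (toℕ j))
        ≈⟨ *-congʳ (f (suc (toℕ j))) (∣⇒≈0 (prime∣binomial p-prime (s≤s z≤n) (s≤s (toℕ<n j)))) ⟩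
      + 0 * f (suc (toℕ j)) ≡⟨ ℤ.*-zeroˡ (f (suc (toℕ j))) ⟩
      + 0                   ∎

  ≈-cancel-2 : ∀ {p a b} → Prime p → p ≢ 2 → + 2 * a ≈ + 2 * b [mod p ] → a ≈ b [mod p ]
  ≈-cancel-2 {p} {a} {b} p-prime p≢2 (divides-difference p∣2a-2b)
    with euclidsLemma 2 ∣ a - b ∣ p-prime (subst (p ℕ.∣_) ∣2a-2b∣≡2∣a-b∣ p∣2a-2b)
    where
    ∣2a-2b∣≡2∣a-b∣ : ∣ + 2 * a - + 2 * b ∣ ≡ 2 ℕ.* ∣ a - b ∣
    ∣2a-2b∣≡2∣a-b∣ = trans (cong ∣_∣ (factor a b)) (ℤ.abs-* (+ 2) (a - b))
      where factor : ∀ a b → + 2 * a - + 2 * b ≡ + 2 * (a - b)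
            factor = solve-∀
  ... | inj₁ p∣2 = contradiction (ℕ.≤-antisym (ℕ.∣⇒≤ p∣2) (prime>1 p-prime)) p≢2
  ... | inj₂ p∣a-b = divides-difference p∣a-b

  -- For odd p, (1 + √5) ^ p ≡ 1 + t √5 with t = √5^₁ p; comparing √5-parts of (1 + √5) ^ p and
  -- (1 + √5) ^ (p + 1) = (1 + √5) ^ p (1 + √5) gives 2 F p ≡ 2 t and 0 ≡ 2 (t + 1).
  F[p+1]≈0⇒F[p]≈-1 : ∀ {p} → Prime p → F (suc p) ≈ + 0 [mod p ] → F p ≈ -1ℤ [mod p ]
  F[p+1]≈0⇒F[p]≈-1 {p} p-prime F[p+1]≈0 with p ℕ.≟ 2
  ... | yes refl = divides-difference (ℕ.divides 1 refl)
  ... | no p≢2 with odd-prime p-prime p≢2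
  ...   | m , refl = ≈-cancel-2 p-prime p≢2 (begin
      + 2 * F p             ≈⟨ *-congʳ (F p) (≈-sym 2^p≈2) ⟩
      (+ 2) ^ p * F p       ≡⟨ sym (proj₁ (G-H-fib p)) ⟩
      + 2 * G p             ≈⟨ *-congˡ (+ 2) G[p]≈t ⟩
      + 2 * t               ≡⟨ shift-by-2 t ⟩
      + 2 * (t + + 1) - + 2 ≈⟨ +-cong 2[t+1]≈0 (≈-refl {a = - + 2}) ⟩
      + 2 * -1ℤ             ∎)
    where
    t = √5^₁ p
    G[p]≈t : G p ≈ t [mod p ]
    G[p]≈t = ≈-trans (binomialSum-prime p-prime √5^₁) (≈-reflexive (ℤ.+-identityˡ t))
    H[p]≈1 : H p ≈ + 1 [mod p ]
    H[p]≈1 = ≈-trans (binomialSum-prime p-prime √5^₀) (≈-reflexive (cong (λ s → + 1 + + 5 * s) (√5^₁-even m)))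
    2^p≈2 : (+ 2) ^ p ≈ + 2 [mod p ]
    2^p≈2 = ≈-trans (≈-reflexive (sym (binomialSum-ones p))) (binomialSum-prime p-prime (λ _ → + 1))
    2[t+1]≈0 : + 2 * (t + + 1) ≈ + 0 [mod p ]
    2[t+1]≈0 = begin
      + 2 * (t + + 1)           ≈⟨ *-congˡ (+ 2) (+-cong (≈-sym G[p]≈t) (≈-sym H[p]≈1)) ⟩
      + 2 * (G p + H p)         ≡⟨ cong (λ s → + 2 * s) (sym (binomialSum-pascal p √5^₁)) ⟩
      + 2 * G (suc p)           ≡⟨ proj₁ (G-H-fib (suc p)) ⟩
      (+ 2) ^ suc p * F (suc p) ≈⟨ *-congˡ ((+ 2) ^ suc p) F[p+1]≈0 ⟩
      (+ 2) ^ suc p * + 0       ≡⟨ ℤ.*-zeroʳ ((+ 2) ^ suc p) ⟩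
      + 0                       ∎
    shift-by-2 : ∀ t → + 2 * t ≡ + 2 * (t + + 1) - + 2
    shift-by-2 = solve-∀

open import Data.Nat using (_+_; _*_)
open import Data.Nat.Divisibility using (_∣_)

theorem12 : (p : ℕ) → Prime p → p ∣ fib (p + 1) →
    ((k : ℕ) → (R (2 * k + 1) ^ᴹ (p + 1)) ≡ᴹ identity (2 * k + 1) [mod p ])
    × ((k : ℕ) → (R (2 * suc k) ^ᴹ (p + 1)) ≡ᴹ negM (identity (2 * suc k)) [mod p ])
theorem12 p p-prime p∣F[p+1] rewrite ℕ.+-comm p 1 =
    (λ k → subst (λ n → (R n ^ᴹ suc p) ≡ᴹ identity n [mod p ]) (ℕ.+-comm 1 (2 * k))
                 (R^-≈identity-odd p F[p]≈-1 F[p+1]≈0 k))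
  , R^-≈negM-even p F[p]≈-1 F[p+1]≈0
  where
  F[p+1]≈0 : F (suc p) ≈ + 0 [mod p ]
  F[p+1]≈0 = ∣⇒≈0 p∣F[p+1]
  F[p]≈-1 : F p ≈ -1ℤ [mod p ]
  F[p]≈-1 = F[p+1]≈0⇒F[p]≈-1 p-prime F[p+1]≈0
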